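{- For all integers $k\ge 1$, $\ell\ge 0$ and every $N\ge 0$ divisible by $\ell+1$, $C_{N,k,\ell}=(\ell+1)\,C_{\frac{N}{\ell+1},k,0}$ and $A_{N,k,\ell}=A_{\frac{N}{\ell+1},k,0}$.
   Context: The $(N,k,\ell)$-growth game (integers $N\ge 0$, $k\ge1$, $\ell\ge0$): there are $k$ subarrays $A_1,\dots,A_k$, initially empty; $a_i$ denotes the number of items in $A_i$. At all times the empty subarrays (those with $a_i=0$) form a prefix ($a_i=0\Rightarrow a_1=\dots=a_{i}=0$), the first nonempty subarray has a capacity exceeding its number of items by at most $\ell$ (up to $\ell$ vacant positions), and all other nonempty subarrays are full. $N$ items are inserted one by one; each insertion is performed as follows. (a) If the first nonempty subarray has a vacant position, the item is placed there; cost $1$. (b) Otherwise, if some subarray is empty, the last empty subarray $A_i$ (largest $i$ with $a_i=0$) becomes a new subarray of capacity $\ell+1$ containing the new item; cost $1$. (c) Otherwise (all $k$ subarrays nonempty and full), the player chooses $i\in\{1,\dots,k\}$; a new subarray of capacity $\ell+1+\sum_{j=1}^i a_j$ is formed containing the items of $A_i,A_{i-1},\dots,A_1$ followed by the new item; it becomes the new $A_i$ and $A_1,\dots,A_{i-1}$ become empty; cost $1+\sum_{j=1}^i a_j$. $C_{N,k,\ell}$ denotes the minimum total cost of inserting all $N$ items, and $A_{N,k,\ell}=C_{N,k,\ell}/N$. -}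

module Defs where

open import Data.Nat using (ℕ; zero; suc; _+_; _<ᵇ_; _⊓_)
open import Data.Nat.Properties using ()
open import Data.Bool using (Bool; true; false; if_then_else_)
open import Data.Product using (_×_; _,_; proj₁; proj₂)
open import Data.Maybe using (Maybe; just; nothing)
open import Data.List using (List; []; _∷_; map; take; drop; replicate; _++_; upTo)
open import Data.Nat.ListAction using (sum)
open import Data.Integer using (+_)
open import Data.Rational using (ℚ; _/_)
import Data.Rational as ℚ

-- A configuration of the (N,k,ℓ)-growth game: the list [A_1, …, A_k] of
-- subarrays, each recorded as (number of items a_i , capacity).
-- (Only the numbers of items matter for the cost, not the item identities.)
Subarray : Set
Subarray = ℕ × ℕ

Config : Set
Config = List Subarray

initial : ℕ → Config
initial k = replicate k (0 , 0)

fillFirst : Config → Maybe Config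
fillFirst [] = nothing
fillFirst ((zero , c) ∷ xs) with fillFirst xs
... | just ys = just ((zero , c) ∷ ys)
... | nothing = nothing
fillFirst ((suc a , c) ∷ xs) =
  if suc a <ᵇ c then just ((suc (suc a) , c) ∷ xs) else nothing

placeLastEmpty : ℕ → Config → Maybe Config
placeLastEmpty ℓ [] = nothing
placeLastEmpty ℓ (x ∷ xs) with placeLastEmpty ℓ xs
... | just ys = just (x ∷ ys)
... | nothing with proj₁ x
...   | zero  = just ((1 , suc ℓ) ∷ xs)
...   | suc _ = nothing

prefixItems : ℕ → Config → ℕ
prefixItems i s = sum (map proj₁ (take i s))

merge : ℕ → ℕ → Config → Config
merge ℓ i s =
  replicate (i Data.Nat.∸ 1) (0 , 0)
    ++ ((suc (prefixItems i s) , suc (ℓ + prefixItems i s)) ∷ drop i s)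

minimum : ℕ → List ℕ → ℕ
minimum d [] = d
minimum d (x ∷ []) = x
minimum d (x ∷ y ∷ xs) = x ⊓ minimum d (y ∷ xs)

-- optCost ℓ k n s : minimum total cost of inserting n more items starting from
-- configuration s (a configuration with k subarrays), the player choosing
-- i ∈ {1,…,k} optimally in every application of rule (c).
optCost : ℕ → ℕ → ℕ → Config → ℕ
optCost ℓ k zero s = 0
optCost ℓ k (suc n) s with fillFirst s
... | just s′ = suc (optCost ℓ k n s′)
... | nothing with placeLastEmpty ℓ s
...   | just s′ = suc (optCost ℓ k n s′)
...   | nothing =
        minimum 0 (map (λ i → suc (prefixItems i s) + optCost ℓ k n (merge ℓ i s))
                       (map suc (upTo k)))

C : ℕ → ℕ → ℕ → ℕ
C N k ℓ = optCost ℓ k N (initial k)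

-- A_{N,k,ℓ} = C_{N,k,ℓ} / N  (as a rational; convention A = 0 when N = 0)
A : ℕ → ℕ → ℕ → ℚ
A zero k ℓ = ℚ.0ℚ
A (suc N) k ℓ = (+ C (suc N) k ℓ) / suc N

{-# OPTIONS --safe #-}
-- Play the ℓ-game in rounds of ℓ + 1 insertions. At the start of a round every
-- nonempty subarray is full, and a full subarray with s items in the 0-game is
-- matched by one with (ℓ + 1) s items in the ℓ-game. A round consists of one
-- rule (b) or (c) step, which is forced or chosen exactly as the corresponding
-- single step of the 0-game and costs ℓ + 1 times as much, followed by ℓ forced
-- fills of cost 1 which restore the invariant.
module Submission where

open import Defs
open import Data.Nat using (ℕ; zero; suc; _+_; _*_; _∸_; _≥_; _/_; _<ᵇ_; _⊓_)
open import Data.Nat.Properties using (+-comm; +-suc; +-identityʳ; *-comm; *-assoc; *-distribʳ-⊓)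
open import Data.Nat.Divisibility using (_∣_; divides)
open import Data.Nat.DivMod using (m*n/n≡m)
open import Data.Nat.Tactic.RingSolver using (solve-∀)
open import Data.Bool using (false; true)
open import Data.Product using (_×_; _,_)
open import Data.Maybe using (just; nothing)
open import Data.List using (List; []; _∷_; map; drop; replicate; _++_; upTo)
open import Data.List.Properties using (drop-map; map-cong; map-∘; ++-identityʳ)
import Data.Integer as ℤ
import Data.Integer.Properties as ℤ
import Data.Rational as ℚ
open import Data.Rational.Properties using (fromℚᵘ-cong)
import Data.Rational.Unnormalised as ℚᵘ
open import Relation.Binary.PropositionalEquality
  using (_≡_; refl; sym; trans; cong; cong₂; module ≡-Reasoning)
open ≡-Reasoning

empties : ℕ → Config
empties z = replicate z (0 , 0)

full : ℕ → Subarray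
full b = (suc b , suc b)

saturated : ℕ → List ℕ → Config
saturated z bs = empties z ++ map full bs

mergeCost : ℕ → ℕ → ℕ → Config → ℕ → ℕ
mergeCost ℓ k n s i = suc (prefixItems i s) + optCost ℓ k n (merge ℓ i s)

optCost-fillFirst : ∀ ℓ k n s {s′} → fillFirst s ≡ just s′ →
  optCost ℓ k (suc n) s ≡ suc (optCost ℓ k n s′)
optCost-fillFirst ℓ k n s eq rewrite eq = refl

optCost-placeLastEmpty : ∀ ℓ k n s {s′} → fillFirst s ≡ nothing → placeLastEmpty ℓ s ≡ just s′ →
  optCost ℓ k (suc n) s ≡ suc (optCost ℓ k n s′)
optCost-placeLastEmpty ℓ k n s eq₁ eq₂ rewrite eq₁ | eq₂ = refl

optCost-merge : ∀ ℓ k n s → fillFirst s ≡ nothing → placeLastEmpty ℓ s ≡ nothing →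
  optCost ℓ k (suc n) s ≡ minimum 0 (map (mergeCost ℓ k n s) (map suc (upTo k)))
optCost-merge ℓ k n s eq₁ eq₂ rewrite eq₁ | eq₂ = refl

n<ᵇn≡false : ∀ n → (n <ᵇ n) ≡ false
n<ᵇn≡false zero    = refl
n<ᵇn≡false (suc n) = n<ᵇn≡false n

m<ᵇ1+m+n≡true : ∀ m n → (m <ᵇ suc (m + n)) ≡ true
m<ᵇ1+m+n≡true zero    n = refl
m<ᵇ1+m+n≡true (suc m) n = m<ᵇ1+m+n≡true m n

fillFirst-full : ∀ bs → fillFirst (map full bs) ≡ nothing
fillFirst-full []       = refl
fillFirst-full (b ∷ bs) rewrite n<ᵇn≡false b = refl

fillFirst-saturated : ∀ z bs → fillFirst (saturated z bs) ≡ nothing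
fillFirst-saturated zero    bs = fillFirst-full bs
fillFirst-saturated (suc z) bs rewrite fillFirst-saturated z bs = refl

fillFirst-vacant : ∀ z m j rest →
  fillFirst (empties z ++ (suc m , suc (suc m + j)) ∷ rest)
    ≡ just (empties z ++ (suc (suc m) , suc (suc m + j)) ∷ rest)
fillFirst-vacant zero    m j rest rewrite m<ᵇ1+m+n≡true m j = refl
fillFirst-vacant (suc z) m j rest rewrite fillFirst-vacant z m j rest = refl

placeLastEmpty-full : ∀ ℓ bs → placeLastEmpty ℓ (map full bs) ≡ nothing
placeLastEmpty-full ℓ []       = refl
placeLastEmpty-full ℓ (b ∷ bs) rewrite placeLastEmpty-full ℓ bs = refl

placeLastEmpty-empties : ∀ ℓ z s → placeLastEmpty ℓ s ≡ nothing →
  placeLastEmpty ℓ (empties (suc z) ++ s) ≡ just (empties z ++ (1 , suc ℓ) ∷ s)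
placeLastEmpty-empties ℓ zero    s eq rewrite eq = refl
placeLastEmpty-empties ℓ (suc z) s eq rewrite placeLastEmpty-empties ℓ z s eq = refl

optCost-fillUp : ∀ ℓ k n z rest j m →
  optCost ℓ k (j + n) (empties z ++ (suc m , suc (m + j)) ∷ rest)
    ≡ j + optCost ℓ k n (empties z ++ full (m + j) ∷ rest)
optCost-fillUp ℓ k n z rest zero    m rewrite +-identityʳ m = refl
optCost-fillUp ℓ k n z rest (suc j) m rewrite +-suc m j =
  trans (optCost-fillFirst ℓ k (j + n) (empties z ++ (suc m , suc (suc m + j)) ∷ rest) (fillFirst-vacant z m j rest))
        (cong suc (optCost-fillUp ℓ k n z rest j (suc m)))

merge-full : ∀ i bs → merge 0 i (map full bs)
  ≡ saturated (i ∸ 1) (prefixItems i (map full bs) ∷ drop i bs)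
merge-full i bs = cong (λ rest → empties (i ∸ 1) ++ full (prefixItems i (map full bs)) ∷ rest)
                       (drop-map i bs)

minimum-*ʳ : ∀ c xs → minimum 0 (map (_* c) xs) ≡ minimum 0 xs * c
minimum-*ʳ c []           = refl
minimum-*ʳ c (x ∷ [])     = refl
minimum-*ʳ c (x ∷ y ∷ xs) =
  trans (cong (x * c ⊓_) (minimum-*ʳ c (y ∷ xs))) (sym (*-distribʳ-⊓ c x _))

*-cancelʳ-/ : ∀ m n c →
  ℤ.+ (m * suc c) ℚ./ (suc n * suc c) ≡ ℤ.+ m ℚ./ suc n
*-cancelʳ-/ m n c = fromℚᵘ-cong {ℚᵘ.mkℚᵘ (ℤ.+ (m * suc c)) (c + n * suc c)} {ℚᵘ.mkℚᵘ (ℤ.+ m) n}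
  (ℚᵘ.*≡* (begin
    ℤ.+ (m * suc c) ℤ.* ℤ.+ suc n ≡⟨ ℤ.pos-* (m * suc c) (suc n) ⟨
    ℤ.+ (m * suc c * suc n)       ≡⟨ cong ℤ.+_ (*-assoc m (suc c) (suc n)) ⟩
    ℤ.+ (m * (suc c * suc n))     ≡⟨ cong (λ d → ℤ.+ (m * d)) (*-comm (suc c) (suc n)) ⟩
    ℤ.+ (m * (suc n * suc c))     ≡⟨ ℤ.pos-* m (suc n * suc c) ⟩
    ℤ.+ m ℤ.* ℤ.+ (suc n * suc c) ∎))

-- A full subarray of suc b items in the 0-game corresponds to one of
-- suc b * suc ℓ = suc (stretch ℓ b) items in the ℓ-game.
stretch : ℕ → ℕ → ℕ
stretch ℓ b = b * suc ℓ + ℓ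

prefixItems-stretch : ∀ ℓ i bs →
  prefixItems i (map full (map (stretch ℓ) bs)) ≡ prefixItems i (map full bs) * suc ℓ
prefixItems-stretch ℓ zero    bs       = refl
prefixItems-stretch ℓ (suc i) []       = refl
prefixItems-stretch ℓ (suc i) (b ∷ bs) =
  trans (cong (suc (stretch ℓ b) +_) (prefixItems-stretch ℓ i bs))
        (distrib ℓ b (prefixItems i (map full bs)))
  where
  distrib : ∀ ℓ b p → suc (b * suc ℓ + ℓ) + p * suc ℓ ≡ (suc b + p) * suc ℓ
  distrib = solve-∀

merge-stretch : ∀ ℓ i bs → let P = prefixItems i (map full bs) in
  merge ℓ i (map full (map (stretch ℓ) bs))
    ≡ empties (i ∸ 1) ++ (suc (P * suc ℓ) , suc (stretch ℓ P)) ∷ map full (map (stretch ℓ) (drop i bs))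
merge-stretch ℓ i bs = trans
  (cong₂ (λ p rest → empties (i ∸ 1) ++ (suc p , suc (ℓ + p)) ∷ rest)
         (prefixItems-stretch ℓ i bs)
         (trans (drop-map i (map (stretch ℓ) bs)) (cong (map full) (drop-map i bs))))
  (cong (λ c → empties (i ∸ 1) ++ (suc (P * suc ℓ) , suc c) ∷ map full (map (stretch ℓ) (drop i bs)))
        (+-comm ℓ (P * suc ℓ)))
  where P = prefixItems i (map full bs)

module Scaling (ℓ k : ℕ) where

  Scales : ℕ → Set
  Scales n = ∀ z bs → optCost ℓ k (n * suc ℓ) (saturated z (map (stretch ℓ) bs))
                        ≡ optCost 0 k n (saturated z bs) * suc ℓ

  optCost-fillNew : ∀ n → Scales n → ∀ z b rest →
    optCost ℓ k (ℓ + n * suc ℓ)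
      (empties z ++ (suc (b * suc ℓ) , suc (stretch ℓ b)) ∷ map full (map (stretch ℓ) rest))
      ≡ ℓ + optCost 0 k n (saturated z (b ∷ rest)) * suc ℓ
  optCost-fillNew n ih z b rest =
    trans (optCost-fillUp ℓ k (n * suc ℓ) z _ ℓ (b * suc ℓ))
          (cong (ℓ +_) (ih z (b ∷ rest)))

  scales-place : ∀ n → Scales n → ∀ z bs →
    optCost ℓ k (suc n * suc ℓ) (saturated (suc z) (map (stretch ℓ) bs))
      ≡ optCost 0 k (suc n) (saturated (suc z) bs) * suc ℓ
  scales-place n ih z bs = begin
      optCost ℓ k (suc n * suc ℓ) (saturated (suc z) (map (stretch ℓ) bs))
    ≡⟨ optCost-placeLastEmpty ℓ k (ℓ + n * suc ℓ) (saturated (suc z) (map (stretch ℓ) bs))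
         (fillFirst-saturated (suc z) (map (stretch ℓ) bs))
         (placeLastEmpty-empties ℓ z (map full (map (stretch ℓ) bs)) (placeLastEmpty-full ℓ (map (stretch ℓ) bs))) ⟩
      suc (optCost ℓ k (ℓ + n * suc ℓ) (empties z ++ (1 , suc ℓ) ∷ map full (map (stretch ℓ) bs)))
    ≡⟨ cong suc (optCost-fillNew n ih z 0 bs) ⟩
      suc (ℓ + optCost 0 k n (saturated z (0 ∷ bs)) * suc ℓ)
    ≡⟨ cong (_* suc ℓ) (optCost-placeLastEmpty 0 k n (saturated (suc z) bs)
         (fillFirst-saturated (suc z) bs)
         (placeLastEmpty-empties 0 z (map full bs) (placeLastEmpty-full 0 bs))) ⟨
      optCost 0 k (suc n) (saturated (suc z) bs) * suc ℓ
    ∎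

  mergeCost-stretch : ∀ n → Scales n → ∀ bs i →
    mergeCost ℓ k (ℓ + n * suc ℓ) (map full (map (stretch ℓ) bs)) i
      ≡ mergeCost 0 k n (map full bs) i * suc ℓ
  mergeCost-stretch n ih bs i = begin
      suc (prefixItems i s) + optCost ℓ k (ℓ + n * suc ℓ) (merge ℓ i s)
    ≡⟨ cong₂ (λ p s′ → suc p + optCost ℓ k (ℓ + n * suc ℓ) s′)
             (prefixItems-stretch ℓ i bs) (merge-stretch ℓ i bs) ⟩
      suc (P * suc ℓ) + optCost ℓ k (ℓ + n * suc ℓ)
        (empties (i ∸ 1) ++ (suc (P * suc ℓ) , suc (stretch ℓ P)) ∷ map full (map (stretch ℓ) (drop i bs)))
    ≡⟨ cong (suc (P * suc ℓ) +_) (optCost-fillNew n ih (i ∸ 1) P (drop i bs)) ⟩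
      suc (P * suc ℓ) + (ℓ + optCost 0 k n (saturated (i ∸ 1) (P ∷ drop i bs)) * suc ℓ)
    ≡⟨ distrib ℓ P _ ⟩
      (suc P + optCost 0 k n (saturated (i ∸ 1) (P ∷ drop i bs))) * suc ℓ
    ≡⟨ cong (λ s′ → (suc P + optCost 0 k n s′) * suc ℓ) (merge-full i bs) ⟨
      mergeCost 0 k n (map full bs) i * suc ℓ
    ∎
    where
    s = map full (map (stretch ℓ) bs)
    P = prefixItems i (map full bs)
    distrib : ∀ ℓ p c → suc (p * suc ℓ) + (ℓ + c * suc ℓ) ≡ (suc p + c) * suc ℓ
    distrib = solve-∀

  scales-merge : ∀ n → Scales n → ∀ bs →
    optCost ℓ k (suc n * suc ℓ) (saturated 0 (map (stretch ℓ) bs))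
      ≡ optCost 0 k (suc n) (saturated 0 bs) * suc ℓ
  scales-merge n ih bs = begin
      optCost ℓ k (suc n * suc ℓ) (map full (map (stretch ℓ) bs))
    ≡⟨ optCost-merge ℓ k (ℓ + n * suc ℓ) (map full (map (stretch ℓ) bs))
         (fillFirst-full (map (stretch ℓ) bs)) (placeLastEmpty-full ℓ (map (stretch ℓ) bs)) ⟩
      minimum 0 (map (mergeCost ℓ k (ℓ + n * suc ℓ) (map full (map (stretch ℓ) bs))) choices)
    ≡⟨ cong (minimum 0) (trans (map-cong (mergeCost-stretch n ih bs) choices) (map-∘ choices)) ⟩
      minimum 0 (map (_* suc ℓ) (map (mergeCost 0 k n (map full bs)) choices))
    ≡⟨ minimum-*ʳ (suc ℓ) (map (mergeCost 0 k n (map full bs)) choices) ⟩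
      minimum 0 (map (mergeCost 0 k n (map full bs)) choices) * suc ℓ
    ≡⟨ cong (_* suc ℓ) (optCost-merge 0 k n (map full bs) (fillFirst-full bs) (placeLastEmpty-full 0 bs)) ⟨
      optCost 0 k (suc n) (map full bs) * suc ℓ
    ∎
    where choices = map suc (upTo k)

  optCost-stretch : ∀ n → Scales n
  optCost-stretch zero    z       bs = refl
  optCost-stretch (suc n) (suc z) bs = scales-place n (optCost-stretch n) z bs
  optCost-stretch (suc n) zero    bs = scales-merge n (optCost-stretch n) bs

C-stretch : ∀ q k ℓ → C (q * suc ℓ) k ℓ ≡ C q k 0 * suc ℓ
C-stretch q k ℓ = begin
    optCost ℓ k (q * suc ℓ) (empties k)
  ≡⟨ cong (optCost ℓ k (q * suc ℓ)) (++-identityʳ (empties k)) ⟨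
    optCost ℓ k (q * suc ℓ) (saturated k [])
  ≡⟨ Scaling.optCost-stretch ℓ k q k [] ⟩
    optCost 0 k q (saturated k []) * suc ℓ
  ≡⟨ cong (λ s → optCost 0 k q s * suc ℓ) (++-identityʳ (empties k)) ⟩
    C q k 0 * suc ℓ
  ∎

A-stretch : ∀ q k ℓ → A (q * suc ℓ) k ℓ ≡ A q k 0
A-stretch zero    k ℓ = refl
A-stretch (suc q) k ℓ =
  trans (cong (λ c → ℤ.+ c ℚ./ (suc q * suc ℓ)) (C-stretch (suc q) k ℓ))
        (*-cancelʳ-/ (C (suc q) k 0) q ℓ)

-- k ≥ 1 is not needed: for k = 0 both costs are the default 0 of an empty minimum.
lemma8p2 : (N k ℓ : ℕ) → k ≥ 1 → suc ℓ ∣ N →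
    (C N k ℓ ≡ suc ℓ * C (N / suc ℓ) k 0) × (A N k ℓ ≡ A (N / suc ℓ) k 0)
lemma8p2 N k ℓ _ (divides q refl) rewrite m*n/n≡m q (suc ℓ) ⦃ _ ⦄ =
  trans (C-stretch q k ℓ) (*-comm (C q k 0) (suc ℓ)) , A-stretch q k ℓ
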